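{- Let $G=(A,B,E)$ be a bipartite graph with a proper edge coloring $\chi:E\to\{1,\dots,d\}$, $d\ge2$, let $G'=(A,B,E')$ be the output (for any outcome of the random choices) of lexicographic thinning of $G$, let $\chi'$ be the type edge coloring of $G'$, and let $k\ge2$. If a subgraph $G''=(A,B,E'')$ of $G'$, with edge coloring $\chi'$, has no $(k',A)$-slow walk for any $2\le k'<k$, then $G''$ with edge coloring $\chi$ has no $(k,B)$-slow walk.
   Context: A bipartite graph is a triple $G=(A,B,E)$ with disjoint $A,B$ and $E\subseteq A\times B$, edges written $(x,y)$ with $x\in A$, $y\in B$. A walk of length $m$ is $v_0,\dots,v_m$ with consecutive vertices adjacent and $v_{i-2}\ne v_i$; its coloring is the sequence of its edge colors. For $k\ge2$, a $k$-slow walk is a walk of length $2k$ whose coloring $(c_1,\dots,c_{2k})$ satisfies: $c_{2j-1}>c_{2j}$ for $1\le j\le k/2$; $c_{2j}<c_{2j+1}$ for $1\le j<k/2$; $c_{2j-1}<c_{2j}$ for $k/2<j\le k$; $c_{2j}>c_{2j+1}$ for $k/2\le j<k$; and $c_1\ge c_{2k}$. It is a $(k,B)$-slow walk if $v_0\in B$ and a $(k,A)$-slow walk if $v_0\in A$. For distinct $a,b\in\{0,1\}^t$, $P(a,b)$ is the first position where they differ; $\{0,1\}^t$ is ordered lexicographically. Lexicographic thinning: $t=\lceil(\log_2 d)/2\rceil+1$; $H$ is the set of triples $(a,i,z)$ with $a\in\{0,1\}^t$, $i\in\{2,\dots,t\}$, $z\in\{1,\dots,2^i\}$, $a$ having $0$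 in position $i$, ordered by $(a,i,z)<(b,j,s)$ iff $a<b$, or $a=b$ and $i<j$, or $(a,i)=(b,j)$ and $z<s$. A random $F:\{1,\dots,d\}\to H$ is chosen with $F(1)$ uniform among elements whose $a$ has first bit $0$ and $F(k)$ the successor of $F(k-1)$ in $H$. An edge $e$ with $F(\chi(e))=(a,i,z)$ has class $a$ and type $i$. Independent uniform $a_x\in\{0,1\}^t$ are chosen for all vertices. An edge $(x,y)$ of class $a$ and type $i$ is eligible if $a=a_y<a_x$ and $P(a,a_x)=i$; $E'$ consists of the eligible edges not adjacent to another eligible edge of the same type. The type edge coloring of $G'$ is $\chi':E'\to\{1,\dots,t-1\}$, $\chi'(e)=t+1-i$ for $e$ of type $i$ (it is a proper edge coloring). -}

module Defs where

open import Data.Nat using (ℕ; zero; suc; _+_; _*_; _∸_; _^_; _≤_; _<_; _>_; _≥_; ⌈_/2⌉)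
open import Data.Nat.Logarithm using (⌈log₂_⌉)
open import Data.Bool using (Bool; true; false)
open import Data.Bool.Properties using () renaming (_≟_ to _≟ᵇ_)
open import Data.Vec using (Vec; []; _∷_)
open import Data.Sum using (_⊎_; inj₁; inj₂)
open import Data.Product using (_×_; _,_; proj₁; proj₂; Σ)
open import Data.Empty using (⊥)
open import Data.Unit using (⊤)
open import Relation.Nullary using (¬_; yes; no)
open import Relation.Binary.PropositionalEquality using (_≡_; _≢_)

-- Bipartite graphs G = (A , B , E): A, B arbitrary types, E ⊆ A × B
-- given as a relation.  Vertices are A ⊎ B.  An edge coloring is a
-- function χ : A → B → ℕ; only its values on edges matter.

Rel₂ : Set → Set → Set₁
Rel₂ A B = A → B → Set

Adj : {A B : Set} → Rel₂ A B → A ⊎ B → A ⊎ B → Set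
Adj E (inj₁ x) (inj₂ y) = E x y
Adj E (inj₂ y) (inj₁ x) = E x y
Adj E (inj₁ _) (inj₁ _) = ⊥
Adj E (inj₂ _) (inj₂ _) = ⊥

-- color of the edge between two vertices (0 for non-adjacent pairs,
-- never used on walks)
edgeCol : {A B : Set} → (A → B → ℕ) → A ⊎ B → A ⊎ B → ℕ
edgeCol χ (inj₁ x) (inj₂ y) = χ x y
edgeCol χ (inj₂ y) (inj₁ x) = χ x y
edgeCol χ (inj₁ _) (inj₁ _) = 0
edgeCol χ (inj₂ _) (inj₂ _) = 0

ProperColoring : {A B : Set} → Rel₂ A B → ℕ → (A → B → ℕ) → Set
ProperColoring {A} {B} E d χ =
  (∀ x y → E x y → 1 ≤ χ x y × χ x y ≤ d)
  × (∀ x y y′ → E x y → E x y′ → y ≢ y′ → χ x y ≢ χ x y′)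
  × (∀ x x′ y → E x y → E x′ y → x ≢ x′ → χ x y ≢ χ x′ y)

-- Walks and slow walks.  A walk of length m is v 0, …, v m (v : ℕ → V,
-- values beyond m irrelevant).

IsWalk : {A B : Set} → Rel₂ A B → ℕ → (ℕ → A ⊎ B) → Set
IsWalk E m v =
  (∀ i → i < m → Adj E (v i) (v (suc i)))
  × (∀ i → 2 + i ≤ m → v i ≢ v (2 + i))

walkColoring : {A B : Set} → (A → B → ℕ) → (ℕ → A ⊎ B) → ℕ → ℕ
walkColoring χ v j = edgeCol χ (v (j ∸ 1)) (v j)

-- the k-slow conditions on a coloring c (indices 1..2k); "j ≤ k/2" is
-- written 2*j ≤ k, etc.
SlowColoring : ℕ → (ℕ → ℕ) → Set
SlowColoring k c =
  (∀ j → 1 ≤ j → 2 * j ≤ k → c (2 * j ∸ 1) > c (2 * j))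
  × (∀ j → 1 ≤ j → 2 * j < k → c (2 * j) < c (2 * j + 1))
  × (∀ j → k < 2 * j → j ≤ k → c (2 * j ∸ 1) < c (2 * j))
  × (∀ j → k ≤ 2 * j → j < k → c (2 * j) > c (2 * j + 1))
  × (c 1 ≥ c (2 * k))

SlowWalk : {A B : Set} → Rel₂ A B → (A → B → ℕ) → ℕ → (ℕ → A ⊎ B) → Set
SlowWalk E χ k v = IsWalk E (2 * k) v × SlowColoring k (walkColoring χ v)

StartsInA : {A B : Set} → A ⊎ B → Set
StartsInA (inj₁ _) = ⊤
StartsInA (inj₂ _) = ⊥

StartsInB : {A B : Set} → A ⊎ B → Set
StartsInB (inj₁ _) = ⊥
StartsInB (inj₂ _) = ⊤

SlowWalkA : {A B : Set} → Rel₂ A B → (A → B → ℕ) → ℕ → (ℕ → A ⊎ B) → Set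
SlowWalkA E χ k v = SlowWalk E χ k v × StartsInA (v 0)

SlowWalkB : {A B : Set} → Rel₂ A B → (A → B → ℕ) → ℕ → (ℕ → A ⊎ B) → Set
SlowWalkB E χ k v = SlowWalk E χ k v × StartsInB (v 0)

-- Bit strings {0,1}^t (false = 0, true = 1), positions 1-based.

Bits : ℕ → Set
Bits t = Vec Bool t

-- bit at (1-based) position i; false outside 1..n (never used there)
bitAt : {n : ℕ} → Bits n → ℕ → Bool
bitAt [] _ = false
bitAt (x ∷ a) zero = false
bitAt (x ∷ a) (suc zero) = x
bitAt (x ∷ a) (suc (suc i)) = bitAt a (suc i)

_<ₗ_ : {n : ℕ} → Bits n → Bits n → Set
[] <ₗ [] = ⊥
(x ∷ a) <ₗ (y ∷ b) = (x ≡ false × y ≡ true) ⊎ (x ≡ y × a <ₗ b)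

-- P(a,b): first (1-based) position where a and b differ
-- (returns 0 when a = b, a case never used)
P : {n : ℕ} → Bits n → Bits n → ℕ
P [] [] = 0
P (x ∷ a) (y ∷ b) with x ≟ᵇ y
... | yes _ = suc (P a b)
... | no _ = 1

-- t = ⌈(log₂ d)/2⌉ + 1  ( = ⌈⌈log₂ d⌉/2⌉ + 1 )
tOf : ℕ → ℕ
tOf d = ⌈ ⌈log₂ d ⌉ /2⌉ + 1

Triple : ℕ → Set
Triple t = Bits t × ℕ × ℕ

tcls : {t : ℕ} → Triple t → Bits t
tcls (a , i , z) = a

ttyp : {t : ℕ} → Triple t → ℕ
ttyp (a , i , z) = i

InH : {t : ℕ} → Triple t → Set
InH {t} (a , i , z) = 2 ≤ i × i ≤ t × 1 ≤ z × z ≤ 2 ^ i × bitAt a i ≡ false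

_<H_ : {t : ℕ} → Triple t → Triple t → Set
(a , i , z) <H (b , j , s) =
  (a <ₗ b) ⊎ (a ≡ b × i < j) ⊎ (a ≡ b × i ≡ j × z < s)

IsSuccH : {t : ℕ} → Triple t → Triple t → Set
IsSuccH h h′ =
  InH h × InH h′ × h <H h′ × (∀ h″ → InH h″ → ¬ (h <H h″ × h″ <H h′))

-- F : {1,…,d} → H is a possible outcome of the random choice of F:
-- F(1) ∈ H has first bit 0 and F(k) is the successor of F(k-1).
ValidF : (d : ℕ) → (ℕ → Triple (tOf d)) → Set
ValidF d F =
  InH (F 1) × bitAt (tcls (F 1)) 1 ≡ false
  × (∀ k → 1 ≤ k → k < d → IsSuccH (F k) (F (suc k)))

module Thinning {A B : Set} (E : Rel₂ A B) (d : ℕ) (χ : A → B → ℕ)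
                (F : ℕ → Triple (tOf d)) (ℓ : A ⊎ B → Bits (tOf d)) where

  classOf : A → B → Bits (tOf d)
  classOf x y = tcls (F (χ x y))

  typeOf : A → B → ℕ
  typeOf x y = ttyp (F (χ x y))

  Eligible : A → B → Set
  Eligible x y =
    E x y
    × classOf x y ≡ ℓ (inj₂ y)
    × classOf x y <ₗ ℓ (inj₁ x)
    × P (classOf x y) (ℓ (inj₁ x)) ≡ typeOf x y

  E′ : A → B → Set
  E′ x y =
    Eligible x y
    × (∀ x′ y′ → Eligible x′ y′ → (x′ ≡ x ⊎ y′ ≡ y) → ¬ (x′ ≡ x × y′ ≡ y)
         → typeOf x′ y′ ≢ typeOf x y)

  χ′ : A → B → ℕ
  χ′ x y = suc (tOf d) ∸ typeOf x y

module Submission where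

-- Let v be a (k,B)-slow walk in E″ and b m = ℓ (v (2m)) the labels of its
-- B-vertices.  (1) At each vertex the types of two E″-edges are ordered like
-- their χ-colors (thinning keeps types distinct at a vertex, F is increasing),
-- so the types along v step in the k-slow directions and χ′ = t + 1 - type in
-- the opposite ones.  (2) Every edge lies below its A-end and leaves it at its
-- type, so a type descent at an A-vertex makes its two B-neighbours agree long,
-- while a type ascent orders them.  (3) The segment of v from an odd position
-- 2n+1, of length 2r with 2n+1+r = k, r ≥ 2, would be an (r,A)-slow walk for χ′
-- unless its end types cross; by hypothesis they do, which is the premise of
-- the mirror lemma on bit strings and yields b 0 <ₗ b k.  (4) The first and last
-- edges of v have classes b 0 and b k, but c_{2k} ≤ c_1 and F increasing force
-- b k ≤ₗ b 0.

open import Defs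
open import Data.Nat using (ℕ; _≤_; _<_)
open import Data.Sum using (_⊎_)
open import Data.Product using (∃)
open import Relation.Nullary using (¬_)

open import Data.Nat using (zero; suc; _+_; _*_; _∸_; _<ᵇ_; _>_; z≤n; s≤s; z<s)
open import Data.Nat.Properties
open import Data.Nat.Tactic.RingSolver using (solve-∀)
open import Data.Bool using (Bool; true; false; not; _xor_)
open import Data.Bool.Properties using (not-involutive; xor-same; not-distribˡ-xor; T-≡)
open import Data.Bool.Properties using () renaming (_≟_ to _≟ᵇ_)
open import Data.Vec using ([]; _∷_)
open import Data.Sum using (inj₁; inj₂)
open import Data.Product using (_×_; _,_; proj₁; proj₂)
open import Data.Empty using (⊥; ⊥-elim)
open import Data.Unit using (tt)
open import Function using (_∘_)
open import Function.Bundles using (Equivalence)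
open import Relation.Nullary using (yes; no)
open import Relation.Binary.Definitions using (tri<; tri≈; tri>)
open import Relation.Binary.PropositionalEquality
  using (_≡_; _≢_; refl; sym; trans; cong; cong₂; subst; subst₂; module ≡-Reasoning)

-- Bit strings: the first difference characterises the lexicographic order.

Agree : {n : ℕ} → ℕ → Bits n → Bits n → Set
Agree i a b = ∀ j → j < i → bitAt a j ≡ bitAt b j

record FirstDiff {n : ℕ} (p : ℕ) (a b : Bits n) : Set where
  constructor firstDiff
  field
    agree-before : Agree p a b
    left-bit     : bitAt a p ≡ false
    right-bit    : bitAt b p ≡ true

_≤ₗ_ : {n : ℕ} → Bits n → Bits n → Set
a ≤ₗ b = a ≡ b ⊎ a <ₗ b

-- position 0 lies before every string, so no first difference is there
bitAt-0 : {n : ℕ} (a : Bits n) → bitAt a 0 ≡ false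
bitAt-0 [] = refl
bitAt-0 (x ∷ a) = refl

false≢true : false ≢ true
false≢true ()

<ₗ⇒FirstDiff : {n : ℕ} {a b : Bits n} → a <ₗ b → FirstDiff (P a b) a b
<ₗ⇒FirstDiff {a = []} {[]} ()
<ₗ⇒FirstDiff {a = x ∷ a} {y ∷ b} lt with x ≟ᵇ y
<ₗ⇒FirstDiff {a = x ∷ a} {y ∷ b} (inj₁ (refl , refl)) | yes ()
<ₗ⇒FirstDiff {a = x ∷ a} {y ∷ b} (inj₁ (refl , refl)) | no _ =
  firstDiff (λ { zero _ → refl ; (suc j) (s≤s ()) }) refl refl
<ₗ⇒FirstDiff {a = x ∷ a} {y ∷ b} (inj₂ (x≡y , _)) | no x≢y = ⊥-elim (x≢y x≡y)
<ₗ⇒FirstDiff {a = x ∷ a} {y ∷ b} (inj₂ (x≡y , lt)) | yes _ with P a b | <ₗ⇒FirstDiff lt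
... | zero  | firstDiff _ _ b0 = ⊥-elim (false≢true (trans (sym (bitAt-0 b)) b0))
... | suc p | firstDiff ag a0 b1 = firstDiff agree a0 b1
  where
  agree : Agree (suc (suc p)) (x ∷ a) (y ∷ b)
  agree zero _ = refl
  agree (suc zero) _ = x≡y
  agree (suc (suc j)) (s≤s j<p) = ag (suc j) j<p

FirstDiff⇒<ₗ : {n p : ℕ} {a b : Bits n} → FirstDiff p a b → a <ₗ b
FirstDiff⇒<ₗ {p = zero} {x ∷ a} {y ∷ b} (firstDiff _ _ ())
FirstDiff⇒<ₗ {p = suc zero} {x ∷ a} {y ∷ b} (firstDiff _ a0 b1) = inj₁ (a0 , b1)
FirstDiff⇒<ₗ {p = suc (suc p)} {x ∷ a} {y ∷ b} (firstDiff ag a0 b1) =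
  inj₂ (ag 1 (s≤s (s≤s z≤n)) , FirstDiff⇒<ₗ (firstDiff tail-agree a0 b1))
  where
  tail-agree : Agree (suc p) a b
  tail-agree zero _ = trans (bitAt-0 a) (sym (bitAt-0 b))
  tail-agree (suc j) (s≤s j<p) = ag (suc (suc j)) (s≤s (s≤s j<p))

<ₗ-trans : {n : ℕ} {a b c : Bits n} → a <ₗ b → b <ₗ c → a <ₗ c
<ₗ-trans {a = []} {[]} {[]} ()
<ₗ-trans {a = x ∷ a} {y ∷ b} {z ∷ c} (inj₁ (p , refl)) (inj₁ (() , _))
<ₗ-trans {a = x ∷ a} {y ∷ b} {z ∷ c} (inj₁ pq) (inj₂ (refl , _)) = inj₁ pq
<ₗ-trans {a = x ∷ a} {y ∷ b} {z ∷ c} (inj₂ (refl , _)) (inj₁ pq) = inj₁ pq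
<ₗ-trans {a = x ∷ a} {y ∷ b} {z ∷ c} (inj₂ (refl , ab)) (inj₂ (refl , bc)) =
  inj₂ (refl , <ₗ-trans ab bc)

<ₗ-irrefl : {n : ℕ} {a : Bits n} → ¬ (a <ₗ a)
<ₗ-irrefl {a = x ∷ a} (inj₁ (refl , ()))
<ₗ-irrefl {a = x ∷ a} (inj₂ (_ , lt)) = <ₗ-irrefl lt

<ₗ-≤ₗ-contra : {n : ℕ} {a b : Bits n} → a <ₗ b → ¬ (b ≤ₗ a)
<ₗ-≤ₗ-contra a<b (inj₁ refl) = <ₗ-irrefl a<b
<ₗ-≤ₗ-contra a<b (inj₂ b<a) = <ₗ-irrefl (<ₗ-trans a<b b<a)

below-common : {n : ℕ} {a a′ α : Bits n} → a <ₗ α → a′ <ₗ α → P a α < P a′ α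
  → FirstDiff (P a α) a a′
below-common a<α a′<α lt with <ₗ⇒FirstDiff a<α | <ₗ⇒FirstDiff a′<α
... | firstDiff ag a0 α1 | firstDiff ag′ _ _ =
  firstDiff (λ j j<p → trans (ag j j<p) (sym (ag′ j (<-trans j<p lt)))) a0 (trans (ag′ _ lt) α1)

FirstDiff-compose : {n q : ℕ} {a b c : Bits n} → a ≤ₗ b → FirstDiff q b c
  → ∃ λ r → r ≤ q × FirstDiff r a c
FirstDiff-compose {q = q} (inj₁ refl) bc = q , ≤-refl , bc
FirstDiff-compose {q = q} (inj₂ a<b) (firstDiff agbc b0 c1) with <ₗ⇒FirstDiff a<b
... | firstDiff agab a0 b1 with <-cmp _ q
...   | tri< p<q _ _ =
  _ , <⇒≤ p<q
    , firstDiff (λ j j<p → trans (agab j j<p) (agbc j (<-trans j<p p<q))) a0 (trans (sym (agbc _ p<q)) b1)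
...   | tri≈ _ refl _ = ⊥-elim (false≢true (trans (sym b0) b1))
...   | tri> _ _ q<p =
  q , ≤-refl
    , firstDiff (λ j j<q → trans (agab j (<-trans j<q q<p)) (agbc j j<q)) (trans (agab q q<p) b0) c1

FirstDiff-transport : {n r D : ℕ} {a a′ c : Bits n} → Agree D a a′ → r < D
  → FirstDiff r a c → FirstDiff r a′ c
FirstDiff-transport ag r<D (firstDiff agac a0 c1) =
  firstDiff (λ j j<r → trans (sym (ag j (<-trans j<r r<D))) (agac j j<r))
    (trans (sym (ag _ r<D)) a0) c1

<H-trans : {t : ℕ} {h₁ h₂ h₃ : Triple t} → h₁ <H h₂ → h₂ <H h₃ → h₁ <H h₃
<H-trans (inj₁ p) (inj₁ q) = inj₁ (<ₗ-trans p q)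
<H-trans (inj₁ p) (inj₂ (inj₁ (refl , _))) = inj₁ p
<H-trans (inj₁ p) (inj₂ (inj₂ (refl , _))) = inj₁ p
<H-trans (inj₂ (inj₁ (refl , _))) (inj₁ q) = inj₁ q
<H-trans (inj₂ (inj₂ (refl , _))) (inj₁ q) = inj₁ q
<H-trans (inj₂ (inj₁ (refl , p))) (inj₂ (inj₁ (refl , q))) = inj₂ (inj₁ (refl , <-trans p q))
<H-trans (inj₂ (inj₁ (refl , p))) (inj₂ (inj₂ (refl , refl , _))) = inj₂ (inj₁ (refl , p))
<H-trans (inj₂ (inj₂ (refl , refl , _))) (inj₂ (inj₁ (refl , q))) = inj₂ (inj₁ (refl , q))
<H-trans (inj₂ (inj₂ (refl , refl , p))) (inj₂ (inj₂ (refl , refl , q))) =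
  inj₂ (inj₂ (refl , refl , <-trans p q))

<H-irrefl : {t : ℕ} {h : Triple t} → ¬ (h <H h)
<H-irrefl (inj₁ p) = <ₗ-irrefl p
<H-irrefl (inj₂ (inj₁ (_ , p))) = <-irrefl refl p
<H-irrefl (inj₂ (inj₂ (_ , _ , p))) = <-irrefl refl p

<H-asym : {t : ℕ} {h h′ : Triple t} → h <H h′ → ¬ (h′ <H h)
<H-asym p q = <H-irrefl (<H-trans p q)

<H⇒class≤ : {t : ℕ} {h h′ : Triple t} → h <H h′ → tcls h ≤ₗ tcls h′
<H⇒class≤ (inj₁ p) = inj₂ p
<H⇒class≤ (inj₂ (inj₁ (p , _))) = inj₁ p
<H⇒class≤ (inj₂ (inj₂ (p , _))) = inj₁ p

module Enumeration (d : ℕ) (F : ℕ → Triple (tOf d)) (vF : ValidF d F) where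

  successor : ∀ c → 1 ≤ c → c < d → IsSuccH (F c) (F (suc c))
  successor = proj₂ (proj₂ vF)

  F-inH : ∀ {c} → 1 ≤ c → c ≤ d → InH (F c)
  F-inH {suc zero} _ _ = proj₁ vF
  F-inH {suc (suc c)} _ c<d = proj₁ (proj₂ (successor (suc c) (s≤s z≤n) c<d))

  F-mono : ∀ {a b} → 1 ≤ a → a < b → b ≤ d → F a <H F b
  F-mono {a} {suc b} 1≤a a<1+b 1+b≤d with m<1+n⇒m<n∨m≡n a<1+b
  ... | inj₂ refl = proj₁ (proj₂ (proj₂ (successor a 1≤a 1+b≤d)))
  ... | inj₁ a<b = <H-trans (F-mono 1≤a a<b (≤-trans (n≤1+n b) 1+b≤d))
                     (proj₁ (proj₂ (proj₂ (successor b (≤-trans 1≤a (<⇒≤ a<b)) 1+b≤d))))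

  class-mono : ∀ {a b} → 1 ≤ a → a ≤ b → b ≤ d → tcls (F a) ≤ₗ tcls (F b)
  class-mono 1≤a a≤b b≤d with m≤n⇒m<n∨m≡n a≤b
  ... | inj₁ a<b = <H⇒class≤ (F-mono 1≤a a<b b≤d)
  ... | inj₂ refl = inj₁ refl

-- Slow colorings as sequences of prescribed step directions.  Step i of a
-- k-slow coloring (from c i to c (1 + i), 1 ≤ i < 2k) ascends exactly when
-- "i is odd" differs from "i < k".

Step : Bool → ℕ → ℕ → Set
Step true a b = a < b
Step false a b = b < a

isOdd : ℕ → Bool
isOdd zero = false
isOdd (suc n) = not (isOdd n)

ascends : ℕ → ℕ → Bool
ascends k i = isOdd i xor (i <ᵇ k)

Steps : ℕ → (ℕ → ℕ) → Set
Steps k c = ∀ i → 1 ≤ i → i < 2 * k → Step (ascends k i) (c i) (c (suc i))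

Step-map : ∀ dir {a b a′ b′} → (a < b → a′ < b′) → (b < a → b′ < a′)
  → Step dir a b → Step dir a′ b′
Step-map true up _ = up
Step-map false _ down = down

Step-reverse : ∀ dir {a b N} → a ≤ N → b ≤ N → Step dir a b → Step (not dir) (N ∸ a) (N ∸ b)
Step-reverse true _ b≤N a<b = ∸-monoʳ-< a<b b≤N
Step-reverse false a≤N _ b<a = ∸-monoʳ-< b<a a≤N

isOdd-+ : ∀ m n → isOdd (m + n) ≡ isOdd m xor isOdd n
isOdd-+ zero n = refl
isOdd-+ (suc m) n = trans (cong not (isOdd-+ m n)) (not-distribˡ-xor (isOdd m) (isOdd n))

isOdd-double : ∀ m → isOdd (2 * m) ≡ false
isOdd-double m = begin
  isOdd (m + (m + 0))          ≡⟨ isOdd-+ m (m + 0) ⟩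
  isOdd m xor isOdd (m + 0)    ≡⟨ cong (λ n → isOdd m xor isOdd n) (+-identityʳ m) ⟩
  isOdd m xor isOdd m          ≡⟨ xor-same (isOdd m) ⟩
  false                        ∎
  where open ≡-Reasoning

<ᵇ-true : ∀ {m n} → m < n → (m <ᵇ n) ≡ true
<ᵇ-true m<n = Equivalence.to T-≡ (<⇒<ᵇ m<n)

<ᵇ-false : ∀ {m n} → n ≤ m → (m <ᵇ n) ≡ false
<ᵇ-false {m} {n} n≤m with m <ᵇ n | <ᵇ⇒< m n
... | false | _ = refl
... | true  | m<n = ⊥-elim (<⇒≱ (m<n tt) n≤m)

<ᵇ-+ : ∀ s {i r} → (s + i <ᵇ s + r) ≡ (i <ᵇ r)
<ᵇ-+ zero = refl
<ᵇ-+ (suc s) = <ᵇ-+ s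

ascends-odd : ∀ k m → ascends k (suc (2 * m)) ≡ not (suc (2 * m) <ᵇ k)
ascends-odd k m rewrite isOdd-double m = refl

ascends-even : ∀ k m → ascends k (2 * m) ≡ (2 * m <ᵇ k)
ascends-even k m rewrite isOdd-double m = refl

double-suc : ∀ m → 2 * suc m ≡ suc (suc (2 * m))
double-suc m = *-suc 2 m

data Shape : ℕ → Set where
  odd  : ∀ m → Shape (suc (2 * m))
  even : ∀ m → Shape (2 * m)

shape : ∀ n → Shape n
shape zero = even 0
shape (suc n) with shape n
... | odd m = subst Shape (double-suc m) (even (suc m))
... | even m = odd m

k≤2k : ∀ k → k ≤ 2 * k
k≤2k k = m≤m+n k (k + 0)

slow⇒steps : ∀ k c → SlowColoring k c → Steps k c
slow⇒steps k c (d₁ , a₁ , a₂ , d₂ , _) i 1≤i i<2k with shape i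
... | even zero = ⊥-elim (n≮0 1≤i)
... | odd m with suc (2 * m) <? k
...   | yes i<k rewrite ascends-odd k m | <ᵇ-true i<k =
  subst (λ z → c z < c (z ∸ 1)) (double-suc m)
    (d₁ (suc m) (s≤s z≤n) (subst (_≤ k) (sym (double-suc m)) i<k))
...   | no i≮k rewrite ascends-odd k m | <ᵇ-false (≮⇒≥ i≮k) =
  subst (λ z → c (z ∸ 1) < c z) (double-suc m)
    (a₂ (suc m) (subst (k <_) (sym (double-suc m)) (s≤s (≮⇒≥ i≮k)))
       (*-cancelˡ-≤ 2 (subst (_≤ 2 * k) (sym (double-suc m)) i<2k)))
slow⇒steps k c (d₁ , a₁ , a₂ , d₂ , _) i 1≤i i<2k | even (suc m) with 2 * suc m <? k
...   | yes i<k rewrite ascends-even k (suc m) | <ᵇ-true i<k =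
  subst (λ z → c (2 * suc m) < c z) (+-comm (2 * suc m) 1) (a₁ (suc m) (s≤s z≤n) i<k)
...   | no i≮k rewrite ascends-even k (suc m) | <ᵇ-false (≮⇒≥ i≮k) =
  subst (λ z → c z < c (2 * suc m)) (+-comm (2 * suc m) 1)
    (d₂ (suc m) (≮⇒≥ i≮k) (*-cancelˡ-< 2 (suc m) k i<2k))

steps⇒slow : ∀ k c → Steps k c → c (2 * k) ≤ c 1 → SlowColoring k c
steps⇒slow k c st end = d₁ , a₁ , a₂ , d₂ , end
  where
  step-at : ∀ i → 1 ≤ i → i < 2 * k → ∀ {dir} → ascends k i ≡ dir → Step dir (c i) (c (suc i))
  step-at i 1≤i i<2k eq = subst (λ dir → Step dir _ _) eq (st i 1≤i i<2k)
  d₁ : ∀ j → 1 ≤ j → 2 * j ≤ k → c (2 * j ∸ 1) > c (2 * j)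
  d₁ (suc m) _ 2j≤k = subst (λ z → c z < c (z ∸ 1)) (sym (double-suc m))
    (step-at (suc (2 * m)) (s≤s z≤n) (<-≤-trans i<k (k≤2k k))
      (trans (ascends-odd k m) (cong not (<ᵇ-true i<k))))
    where
    i<k : suc (2 * m) < k
    i<k = subst (_≤ k) (double-suc m) 2j≤k
  a₁ : ∀ j → 1 ≤ j → 2 * j < k → c (2 * j) < c (2 * j + 1)
  a₁ (suc m) _ 2j<k = subst (λ z → c (2 * suc m) < c z) (+-comm 1 (2 * suc m))
    (step-at (2 * suc m) (s≤s z≤n) (<-≤-trans 2j<k (k≤2k k))
      (trans (ascends-even k (suc m)) (<ᵇ-true 2j<k)))
  a₂ : ∀ j → k < 2 * j → j ≤ k → c (2 * j ∸ 1) < c (2 * j)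
  a₂ zero k<0 _ = ⊥-elim (n≮0 k<0)
  a₂ (suc m) k<2j j≤k = subst (λ z → c (z ∸ 1) < c z) (sym (double-suc m))
    (step-at (suc (2 * m)) (s≤s z≤n)
      (subst (_≤ 2 * k) (double-suc m) (*-monoʳ-≤ 2 j≤k))
      (trans (ascends-odd k m) (cong not (<ᵇ-false k≤i))))
    where
    k≤i : k ≤ suc (2 * m)
    k≤i = ≤-pred (subst (k <_) (double-suc m) k<2j)
  d₂ : ∀ j → k ≤ 2 * j → j < k → c (2 * j) > c (2 * j + 1)
  d₂ zero k≤0 0<k = ⊥-elim (<⇒≱ 0<k k≤0)
  d₂ (suc m) k≤2j j<k = subst (λ z → c z < c (2 * suc m)) (+-comm 1 (2 * suc m))
    (step-at (2 * suc m) (s≤s z≤n) (*-monoʳ-< 2 j<k)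
      (trans (ascends-even k (suc m)) (<ᵇ-false k≤2j)))

ascends-shift : ∀ r s i → isOdd s ≡ true → ascends r i ≡ not (ascends (s + r) (i + s))
ascends-shift r s i s-odd = begin
  isOdd i xor (i <ᵇ r)                            ≡⟨ flip-twice (isOdd i) (i <ᵇ r) ⟩
  not ((isOdd i xor true) xor (i <ᵇ r))           ≡⟨ cong₂ (λ p q → not (p xor q))
                                                       (sym parity) (sym (<ᵇ-+ s)) ⟩
  not (isOdd (i + s) xor (s + i <ᵇ s + r))        ≡⟨ cong (λ n → not (isOdd (i + s) xor (n <ᵇ s + r)))
                                                       (+-comm s i) ⟩
  not (isOdd (i + s) xor (i + s <ᵇ s + r))        ∎
  where
  open ≡-Reasoning
  parity : isOdd (i + s) ≡ isOdd i xor true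
  parity = trans (isOdd-+ i s) (cong (isOdd i xor_) s-odd)
  flip-twice : ∀ x y → x xor y ≡ not ((x xor true) xor y)
  flip-twice true y = refl
  flip-twice false y = sym (not-involutive y)

B→A : {A B : Set} {E : Rel₂ A B} (u w : A ⊎ B) → Adj E u w → StartsInB u → StartsInA w
B→A (inj₂ _) (inj₁ _) _ _ = tt

A→B : {A B : Set} {E : Rel₂ A B} (u w : A ⊎ B) → Adj E u w → StartsInA u → StartsInB w
A→B (inj₁ _) (inj₂ _) _ _ = tt

segment-walk : {A B : Set} {E : Rel₂ A B} {m : ℕ} {v : ℕ → A ⊎ B} → IsWalk E m v
  → ∀ s m′ → s + m′ ≤ m → IsWalk E m′ (λ i → v (i + s))
segment-walk {m = m} (adj , fresh) s m′ s+m′≤m =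
  (λ i i<m′ → adj (i + s) (inside i<m′)) , (λ i 2+i≤m′ → fresh (i + s) (inside 2+i≤m′))
  where
  inside : ∀ {j} → j ≤ m′ → j + s ≤ m
  inside {j} j≤m′ = ≤-trans (≤-reflexive (+-comm j s)) (≤-trans (+-monoʳ-≤ s j≤m′) s+m′≤m)

-- The key fact is
-- that at every vertex the type order of the incident E″-edges agrees with
-- their χ order, so walks in E″ carry their χ step directions over to types.
module ThinnedGraph {A B : Set} (E : Rel₂ A B) (d : ℕ) (χ : A → B → ℕ)
  (pc : ProperColoring E d χ) (F : ℕ → Triple (tOf d)) (vF : ValidF d F)
  (ℓ : A ⊎ B → Bits (tOf d)) (E″ : Rel₂ A B)
  (sub : ∀ x y → E″ x y → Thinning.E′ E d χ F ℓ x y) where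
  open Thinning E d χ F ℓ
  open Enumeration d F vF

  eligible : ∀ {x y} → E″ x y → Eligible x y
  eligible {x} {y} e = proj₁ (sub x y e)

  color-range : ∀ {x y} → E″ x y → 1 ≤ χ x y × χ x y ≤ d
  color-range {x} {y} e = proj₁ pc x y (proj₁ (eligible e))

  type≤t : ∀ {x y} → E″ x y → typeOf x y ≤ tOf d
  type≤t e = proj₁ (proj₂ (F-inH (proj₁ (color-range e)) (proj₂ (color-range e))))

  class-below : ∀ {x y} → E″ x y
    → classOf x y <ₗ ℓ (inj₁ x) × P (classOf x y) (ℓ (inj₁ x)) ≡ typeOf x y
  class-below e = let (_ , _ , below , leaves) = eligible e in below , leaves

  type-mono-at-A : ∀ {x y y′} → E″ x y → E″ x y′ → y ≢ y′ → χ x y < χ x y′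
    → typeOf x y < typeOf x y′
  type-mono-at-A {x} {y} {y′} e e′ y≢y′ lt with <-cmp (typeOf x y) (typeOf x y′)
  ... | tri< p _ _ = p
  ... | tri≈ _ p _ = ⊥-elim (proj₂ (sub x y′ e′) x y (eligible e) (inj₁ refl) (y≢y′ ∘ proj₂) p)
  ... | tri> _ _ gt = ⊥-elim (<ₗ-≤ₗ-contra later-class<earlier
                        (class-mono (proj₁ (color-range e)) (<⇒≤ lt) (proj₂ (color-range e′))))
    where
    later-class<earlier : classOf x y′ <ₗ classOf x y
    later-class<earlier with class-below e | class-below e′
    ... | below , leaves | below′ , leaves′ =
      FirstDiff⇒<ₗ (below-common below′ below (subst₂ _<_ (sym leaves′) (sym leaves) gt))

  type-mono-at-B : ∀ {x x′ y} → E″ x y → E″ x′ y → x ≢ x′ → χ x y < χ x′ y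
    → typeOf x y < typeOf x′ y
  type-mono-at-B {x} {x′} {y} e e′ x≢x′ lt with <-cmp (typeOf x y) (typeOf x′ y)
  ... | tri< p _ _ = p
  ... | tri≈ _ p _ = ⊥-elim (proj₂ (sub x′ y e′) x y (eligible e) (inj₂ refl) (x≢x′ ∘ proj₁) p)
  ... | tri> _ _ gt = ⊥-elim (<H-asym (F-mono (proj₁ (color-range e)) lt (proj₂ (color-range e′)))
                        (inj₂ (inj₁ (same-class , gt))))
    where
    same-class : classOf x′ y ≡ classOf x y
    same-class = trans (proj₁ (proj₂ (eligible e′))) (sym (proj₁ (proj₂ (eligible e))))

  types-follow : ∀ dir u₀ u₁ u₂ → Adj E″ u₀ u₁ → Adj E″ u₁ u₂ → u₀ ≢ u₂
    → Step dir (edgeCol χ u₀ u₁) (edgeCol χ u₁ u₂)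
    → Step dir (edgeCol typeOf u₀ u₁) (edgeCol typeOf u₁ u₂)
  types-follow dir (inj₂ y) (inj₁ x) (inj₂ y′) e e′ ne =
    Step-map dir (type-mono-at-A e e′ (ne ∘ cong inj₂)) (type-mono-at-A e′ e (ne ∘ cong inj₂ ∘ sym))
  types-follow dir (inj₁ x) (inj₂ y) (inj₁ x′) e e′ ne =
    Step-map dir (type-mono-at-B e e′ (ne ∘ cong inj₁)) (type-mono-at-B e′ e (ne ∘ cong inj₁ ∘ sym))
  types-follow dir (inj₁ _) (inj₁ _) _ () _
  types-follow dir (inj₂ _) (inj₂ _) _ () _
  types-follow dir (inj₁ _) (inj₂ _) (inj₂ _) _ ()
  types-follow dir (inj₂ _) (inj₁ _) (inj₁ _) _ ()

  B-below-A : ∀ u w → Adj E″ u w → StartsInB u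
    → ℓ u <ₗ ℓ w × P (ℓ u) (ℓ w) ≡ edgeCol typeOf u w
  B-below-A (inj₂ y) (inj₁ x) e _ =
    subst (λ a → a <ₗ ℓ (inj₁ x) × P a (ℓ (inj₁ x)) ≡ typeOf x y)
      (proj₁ (proj₂ (eligible e))) (class-below e)

  A-above-B : ∀ u w → Adj E″ u w → StartsInA u
    → ℓ w <ₗ ℓ u × P (ℓ w) (ℓ u) ≡ edgeCol typeOf u w
  A-above-B (inj₁ x) (inj₂ y) e _ = B-below-A (inj₂ y) (inj₁ x) e tt

  class-at-B : ∀ u w → Adj E″ u w → StartsInB u → tcls (F (edgeCol χ u w)) ≡ ℓ u
  class-at-B (inj₂ y) (inj₁ x) e _ = proj₁ (proj₂ (eligible e))

  class-at-B′ : ∀ u w → Adj E″ u w → StartsInB w → tcls (F (edgeCol χ u w)) ≡ ℓ w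
  class-at-B′ (inj₁ x) (inj₂ y) e _ = proj₁ (proj₂ (eligible e))

  edge-color-range : ∀ u w → Adj E″ u w → 1 ≤ edgeCol χ u w × edgeCol χ u w ≤ d
  edge-color-range (inj₁ _) (inj₂ _) e = color-range e
  edge-color-range (inj₂ _) (inj₁ _) e = color-range e

  edge-type≤t : ∀ u w → Adj E″ u w → edgeCol typeOf u w ≤ tOf d
  edge-type≤t (inj₁ _) (inj₂ _) e = type≤t e
  edge-type≤t (inj₂ _) (inj₁ _) e = type≤t e

  χ′-by-type : ∀ u w → Adj E″ u w → edgeCol χ′ u w ≡ suc (tOf d) ∸ edgeCol typeOf u w
  χ′-by-type (inj₁ _) (inj₂ _) _ = refl
  χ′-by-type (inj₂ _) (inj₁ _) _ = refl

≤-by : ∀ {a b} c → a + c ≡ b → a ≤ b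
≤-by c refl = m≤m+n _ c

-- Let b 0, …, b k be strings such that consecutive members
-- agree long in the first half (desc), first differ upward in the second half
-- (asc), and every second-half difference U m occurs before the agreement D n
-- of the mirror-image step ends (cross).  Then b n ≤ₗ b (k - n) for all
-- n ≤ k/2, by induction from the middle outward; in particular b 0 <ₗ b k.
module Mirror {t : ℕ} (k : ℕ) (b : ℕ → Bits t) (D U : ℕ → ℕ)
  (desc : ∀ n → 2 * suc n ≤ k → Agree (D n) (b (suc n)) (b n))
  (asc : ∀ m → k ≤ suc (2 * m) → m < k → FirstDiff (U m) (b m) (b (suc m)))
  (cross : ∀ n m → n + suc m ≡ k → 2 * suc n ≤ k → U m < D n) where

  mutual
    mirror≤ : ∀ e n → n + (n + e) ≡ k → b n ≤ₗ b (n + e)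
    mirror≤ zero n _ = inj₁ (cong b (sym (+-identityʳ n)))
    mirror≤ (suc e) n eq = inj₂ (mirror< e n eq)

    mirror< : ∀ e n → n + (n + suc e) ≡ k → b n <ₗ b (n + suc e)
    mirror< zero n refl = subst (λ z → b n <ₗ b z) (+-comm 1 n)
      (FirstDiff⇒<ₗ (asc n (≤-reflexive (odd-middle n)) (≤-by n (below-middle n))))
      where
      odd-middle : ∀ n → n + (n + 1) ≡ suc (2 * n)
      odd-middle = solve-∀
      below-middle : ∀ n → suc n + n ≡ n + (n + 1)
      below-middle = solve-∀
    mirror< (suc e) n refl = subst (λ z → b n <ₗ b z) (sym (+-suc n (suc e)))
      (FirstDiff⇒<ₗ (FirstDiff-transport (desc n (≤-by e (n-in-first-half n e)))
        (≤-<-trans r≤U crossing) diff))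
      where
      -- b m, b (suc m) is the second-half step mirroring b n, b (suc n)
      m : ℕ
      m = n + suc e
      n-in-first-half : ∀ n e → 2 * suc n + e ≡ n + (n + suc (suc e))
      n-in-first-half = solve-∀
      m-in-second-half : ∀ n e → n + (n + suc (suc e)) + suc e ≡ suc (2 * (n + suc e))
      m-in-second-half = solve-∀
      m-below-k : ∀ n e → suc (n + suc e) + n ≡ n + (n + suc (suc e))
      m-below-k = solve-∀
      inner-pair : ∀ n e → suc n + (suc n + e) ≡ n + (n + suc (suc e))
      inner-pair = solve-∀
      inner : b (suc n) ≤ₗ b m
      inner = subst (λ z → b (suc n) ≤ₗ b z) (sym (+-suc n e)) (mirror≤ e (suc n) (inner-pair n e))
      crossing : U m < D n
      crossing = cross n m (cong (n +_) (sym (+-suc n (suc e)))) (≤-by e (n-in-first-half n e))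
      -- b (suc n) ≤ₗ b m <ₗ b (suc m), the last step first differing at U m
      composed : ∃ λ r → r ≤ U m × FirstDiff r (b (suc n)) (b (suc m))
      composed = FirstDiff-compose inner
        (asc m (≤-by (suc e) (m-in-second-half n e)) (≤-by n (m-below-k n e)))
      r≤U : proj₁ composed ≤ U m
      r≤U = proj₁ (proj₂ composed)
      diff : FirstDiff (proj₁ composed) (b (suc n)) (b (suc m))
      diff = proj₂ (proj₂ composed)

  ends-ordered : 1 ≤ k → b 0 <ₗ b k
  ends-ordered 1≤k with m≤n⇒∃[o]m+o≡n 1≤k
  ... | e , refl = mirror< e 0 refl

module SlowBWalk {A B : Set} (E : Rel₂ A B) (d : ℕ) (χ : A → B → ℕ)
  (pc : ProperColoring E d χ) (F : ℕ → Triple (tOf d)) (vF : ValidF d F)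
  (ℓ : A ⊎ B → Bits (tOf d)) (E″ : Rel₂ A B)
  (sub : ∀ x y → E″ x y → Thinning.E′ E d χ F ℓ x y) (k : ℕ)
  (noA : ∀ k′ → 2 ≤ k′ → k′ < k → ¬ ∃ (λ v → SlowWalkA E″ (Thinning.χ′ E d χ F ℓ) k′ v))
  (v : ℕ → A ⊎ B) (walk : IsWalk E″ (2 * k) v) (slow : SlowColoring k (walkColoring χ v))
  (start : StartsInB (v 0)) where
  open Thinning E d χ F ℓ
  open ThinnedGraph E d χ pc F vF ℓ E″ sub
  open Enumeration d F vF

  t : ℕ
  t = tOf d

  c τ c′ : ℕ → ℕ
  c = walkColoring χ v
  τ = walkColoring typeOf v
  c′ = walkColoring χ′ v

  adj : ∀ i → i < 2 * k → Adj E″ (v i) (v (suc i))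
  adj = proj₁ walk

  odd-inside : ∀ m → m < k → suc (2 * m) < 2 * k
  odd-inside m m<k = subst (_≤ 2 * k) (double-suc m) (*-monoʳ-≤ 2 m<k)

  mutual
    even-in-B : ∀ m → m ≤ k → StartsInB (v (2 * m))
    even-in-B zero _ = start
    even-in-B (suc m) m<k = subst (StartsInB ∘ v) (sym (double-suc m))
      (A→B _ _ (adj (suc (2 * m)) (odd-inside m m<k)) (odd-in-A m m<k))

    odd-in-A : ∀ m → m < k → StartsInA (v (suc (2 * m)))
    odd-in-A m m<k =
      B→A _ _ (adj (2 * m) (<-trans (n<1+n _) (odd-inside m m<k))) (even-in-B m (<⇒≤ m<k))

  τ-steps : Steps k τ
  τ-steps (suc i) _ 1+i<2k =
    types-follow (ascends k (suc i)) (v i) (v (suc i)) (v (suc (suc i)))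
      (adj i (<-trans (n<1+n _) 1+i<2k)) (adj (suc i) 1+i<2k)
      (proj₂ walk i 1+i<2k) (slow⇒steps k c slow (suc i) (s≤s z≤n) 1+i<2k)

  τ-step-at : ∀ i → 1 ≤ i → i < 2 * k → ∀ {dir} → ascends k i ≡ dir → Step dir (τ i) (τ (suc i))
  τ-step-at i 1≤i i<2k eq = subst (λ dir → Step dir _ _) eq (τ-steps i 1≤i i<2k)

  c′-by-τ : ∀ i → 1 ≤ i → i ≤ 2 * k → c′ i ≡ suc t ∸ τ i
  c′-by-τ (suc i) _ i<2k = χ′-by-type (v i) (v (suc i)) (adj i i<2k)

  c′-steps : ∀ i → 1 ≤ i → i < 2 * k → Step (not (ascends k i)) (c′ i) (c′ (suc i))
  c′-steps (suc i) 1≤i 1+i<2k =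
    subst₂ (Step _) (sym (c′-by-τ (suc i) (s≤s z≤n) i<2k))
      (sym (c′-by-τ (suc (suc i)) (s≤s z≤n) 1+i<2k))
      (Step-reverse (ascends k (suc i))
        (m≤n⇒m≤1+n (edge-type≤t (v i) (v (suc i)) (adj i i<2k)))
        (m≤n⇒m≤1+n (edge-type≤t (v (suc i)) (v (suc (suc i))) (adj (suc i) 1+i<2k)))
        (τ-steps (suc i) 1≤i 1+i<2k))
    where
    i<2k : i < 2 * k
    i<2k = <-trans (n<1+n _) 1+i<2k

  b : ℕ → Bits t
  b m = ℓ (v (2 * m))

  left-below : ∀ m → m < k
    → b m <ₗ ℓ (v (suc (2 * m))) × P (b m) (ℓ (v (suc (2 * m)))) ≡ τ (suc (2 * m))
  left-below m m<k =
    B-below-A _ _ (adj (2 * m) (<-trans (n<1+n _) (odd-inside m m<k))) (even-in-B m (<⇒≤ m<k))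

  right-below : ∀ m → m < k
    → b (suc m) <ₗ ℓ (v (suc (2 * m))) × P (b (suc m)) (ℓ (v (suc (2 * m)))) ≡ τ (2 * suc m)
  right-below m m<k =
    subst (λ z → ℓ (v z) <ₗ ℓ (v (suc (2 * m))) × P (ℓ (v z)) (ℓ (v (suc (2 * m)))) ≡ τ z)
      (sym (double-suc m)) (A-above-B _ _ (adj (suc (2 * m)) (odd-inside m m<k)) (odd-in-A m m<k))

  -- first half: types descend at 2n+1, so b n and b (n+1) agree before τ (2n+2)
  desc : ∀ n → 2 * suc n ≤ k → Agree (τ (2 * suc n)) (b (suc n)) (b n)
  desc n 2n+2≤k = subst (λ p → Agree p (b (suc n)) (b n)) (proj₂ right)
    (FirstDiff.agree-before (below-common (proj₁ right) (proj₁ left)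
      (subst₂ _<_ (sym (proj₂ right)) (sym (proj₂ left)) descent)))
    where
    i<k : suc (2 * n) < k
    i<k = subst (_≤ k) (double-suc n) 2n+2≤k
    n<k : n < k
    n<k = ≤-<-trans (m≤n*m n 2) (<-trans (n<1+n _) i<k)
    α : Bits t
    α = ℓ (v (suc (2 * n)))
    left : b n <ₗ α × P (b n) α ≡ τ (suc (2 * n))
    left = left-below n n<k
    right : b (suc n) <ₗ α × P (b (suc n)) α ≡ τ (2 * suc n)
    right = right-below n n<k
    descent : τ (2 * suc n) < τ (suc (2 * n))
    descent = subst (λ z → τ z < τ (suc (2 * n))) (sym (double-suc n))
      (τ-step-at (suc (2 * n)) (s≤s z≤n) (<-≤-trans i<k (k≤2k k))
        (trans (ascends-odd k n) (cong not (<ᵇ-true i<k))))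

  -- second half: types ascend at 2m+1, so b m <ₗ b (m+1), first differing at τ (2m+1)
  asc : ∀ m → k ≤ suc (2 * m) → m < k → FirstDiff (τ (suc (2 * m))) (b m) (b (suc m))
  asc m k≤i m<k = subst (λ p → FirstDiff p (b m) (b (suc m))) (proj₂ left)
    (below-common (proj₁ left) (proj₁ right)
      (subst₂ _<_ (sym (proj₂ left)) (sym (proj₂ right)) ascent))
    where
    α : Bits t
    α = ℓ (v (suc (2 * m)))
    left : b m <ₗ α × P (b m) α ≡ τ (suc (2 * m))
    left = left-below m m<k
    right : b (suc m) <ₗ α × P (b (suc m)) α ≡ τ (2 * suc m)
    right = right-below m m<k
    ascent : τ (suc (2 * m)) < τ (2 * suc m)
    ascent = subst (λ z → τ (suc (2 * m)) < τ z) (sym (double-suc m))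
      (τ-step-at (suc (2 * m)) (s≤s z≤n) (odd-inside m m<k)
        (trans (ascends-odd k m) (cong not (<ᵇ-false k≤i))))

  middle : ∀ n → 2 * suc n ≡ k → τ (suc (2 * suc n)) < τ (2 * suc n)
  middle n refl = τ-step-at (2 * suc n) (s≤s z≤n) (m<m+n (2 * suc n) z<s)
    (trans (ascends-even k (suc n)) (<ᵇ-false (≤-refl {2 * suc n})))

  segment-slow : ∀ n q → suc (2 * n) + suc (suc q) ≡ k
    → τ (suc (suc (2 * n))) ≤ τ (2 * suc (suc q) + suc (2 * n))
    → SlowWalkA E″ χ′ (suc (suc q)) (λ i → v (i + suc (2 * n)))
  segment-slow n q refl ends =
    (segment-walk walk s (2 * r) (≤-by s (segment-inside s r)) , steps⇒slow r cw steps end)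
    , odd-in-A n (≤-by (n + suc (suc q)) (n-below n q))
    where
    s r : ℕ
    s = suc (2 * n)
    r = suc (suc q)
    cw : ℕ → ℕ
    cw = walkColoring χ′ (λ i → v (i + s))
    segment-inside : ∀ s r → s + 2 * r + s ≡ 2 * (s + r)
    segment-inside = solve-∀
    n-below : ∀ n q → suc n + (n + suc (suc q)) ≡ suc (2 * n) + suc (suc q)
    n-below = solve-∀
    end-inside : ∀ s r → 2 * r + s + s ≡ 2 * (s + r)
    end-inside = solve-∀
    steps : Steps r cw
    steps (suc i) _ 1+i<2r =
      subst (λ dir → Step dir (cw (suc i)) (cw (suc (suc i))))
        (sym (ascends-shift r s (suc i) (s-odd n)))
        (c′-steps (suc i + s) (s≤s z≤n) (<-≤-trans (+-monoˡ-< s 1+i<2r) (≤-by s (end-inside s r))))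
      where
      s-odd : ∀ n → isOdd (suc (2 * n)) ≡ true
      s-odd n = cong not (isOdd-double n)
    end : cw (2 * r) ≤ cw 1
    end = subst₂ _≤_ (sym (c′-by-τ (2 * r + s) (s≤s z≤n) (≤-by s (end-inside s r))))
      (sym (c′-by-τ (suc s) (s≤s z≤n) (odd-inside n (≤-by (n + suc (suc q)) (n-below n q)))))
      (∸-monoʳ-≤ (suc t) ends)

  cross : ∀ n m → n + suc m ≡ k → 2 * suc n ≤ k → τ (suc (2 * m)) < τ (2 * suc n)
  cross n m eq 2n+2≤k with m≤n⇒m<n∨m≡n 2n+2≤k
  ... | inj₂ 2n+2≡k = subst (λ z → τ (suc (2 * z)) < τ (2 * suc n)) (sym m≡1+n) (middle n 2n+2≡k)
    where
    split : ∀ n → 2 * suc n ≡ n + suc (suc n)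
    split = solve-∀
    m≡1+n : m ≡ suc n
    m≡1+n = suc-injective
      (+-cancelˡ-≡ n (suc m) (suc (suc n)) (trans eq (trans (sym 2n+2≡k) (split n))))
  ... | inj₁ 2n+2<k with m≤n⇒∃[o]m+o≡n 2n+2<k
  ...   | q , refl with τ (suc (2 * m)) <? τ (2 * suc n)
  ...     | yes lt = lt
  ...     | no ≮ = ⊥-elim (noA (suc (suc q)) (s≤s (s≤s z≤n)) (≤-by (2 * n) (r-below n q))
                      (_ , segment-slow n q (k-split n q) ends))
    where
    k-split : ∀ n q → suc (2 * n) + suc (suc q) ≡ suc (2 * suc n) + q
    k-split = solve-∀
    r-below : ∀ n q → suc (suc (suc q)) + 2 * n ≡ suc (2 * suc n) + q
    r-below = solve-∀
    m-split : ∀ n q → suc (2 * suc n) + q ≡ n + suc (n + suc (suc q))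
    m-split = solve-∀
    end-index : ∀ n q → suc (2 * (n + suc (suc q))) ≡ 2 * suc (suc q) + suc (2 * n)
    end-index = solve-∀
    m≡ : m ≡ n + suc (suc q)
    m≡ = suc-injective (+-cancelˡ-≡ n (suc m) _ (trans eq (m-split n q)))
    ends : τ (suc (suc (2 * n))) ≤ τ (2 * suc (suc q) + suc (2 * n))
    ends = subst₂ (λ i j → τ i ≤ τ j) (double-suc n)
      (trans (cong (λ z → suc (2 * z)) m≡) (end-index n q)) (≮⇒≥ ≮)

  -- the first and last edges of v have classes b 0 and b k, in the wrong order
  impossible : 1 ≤ k → ⊥
  impossible 1≤k with m≤n⇒∃[o]m+o≡n 1≤k
  ... | e , refl = <ₗ-≤ₗ-contra ordered
    (subst₂ _≤ₗ_ last-class first-class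
      (class-mono (proj₁ (edge-color-range (v (2 * suc e ∸ 1)) (v (2 * suc e)) last))
        (proj₂ (proj₂ (proj₂ (proj₂ slow))))
        (proj₂ (edge-color-range (v 0) (v 1) first))))
    where
    ordered : b 0 <ₗ b (suc e)
    ordered = Mirror.ends-ordered (suc e) b (λ n → τ (2 * suc n)) (λ m → τ (suc (2 * m)))
      desc asc cross (s≤s z≤n)
    first : Adj E″ (v 0) (v 1)
    first = adj 0 (s≤s z≤n)
    last : Adj E″ (v (2 * suc e ∸ 1)) (v (2 * suc e))
    last = adj (2 * suc e ∸ 1) ≤-refl
    first-class : tcls (F (c 1)) ≡ b 0
    first-class = class-at-B (v 0) (v 1) first start
    last-class : tcls (F (c (2 * suc e))) ≡ b (suc e)
    last-class = class-at-B′ (v (2 * suc e ∸ 1)) (v (2 * suc e)) last (even-in-B (suc e) ≤-refl)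

lemma8 : {A B : Set} (E : Rel₂ A B) (d : ℕ) → 2 ≤ d
    → (χ : A → B → ℕ) → ProperColoring E d χ
    → (F : ℕ → Triple (tOf d)) → ValidF d F
    → (ℓ : A ⊎ B → Bits (tOf d))
    → (E″ : Rel₂ A B) → (∀ x y → E″ x y → Thinning.E′ E d χ F ℓ x y)
    → (k : ℕ) → 2 ≤ k
    → (∀ k′ → 2 ≤ k′ → k′ < k → ¬ ∃ (λ v → SlowWalkA E″ (Thinning.χ′ E d χ F ℓ) k′ v))
    → ¬ ∃ (λ v → SlowWalkB E″ χ k v)
lemma8 E d _ χ pc F vF ℓ E″ sub k 2≤k noA (v , (walk , slow) , start) =
  SlowBWalk.impossible E d χ pc F vF ℓ E″ sub k noA v walk slow start (≤-trans (n≤1+n 1) 2≤k)
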